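{- Let $(G,G_c,k,d)$ be a yes-instance of \textsc{DC Completion (Edge Dist)} in which $G$ is a cluster graph. Then there exists a standard solution for $(G,G_c,k,d)$.
   Context: A cluster graph is a disjoint union of cliques. $A\oplus B$ denotes symmetric difference. \textsc{DC Completion (Edge Dist)}: given a graph $G$ and a cluster graph $G_c$ on the same vertex set $V$ and nonnegative integers $k,d$, decide whether there is a cluster graph $G'=(V,E')$ (a solution) with $E'\supseteq E(G)$, $|E(G)\oplus E'|\le k$ and $|E'\oplus E(G_c)|\le d$. Let $D_1,\dots,D_q$ be the cliques of $G_c$; for a clique $C$ of $G$ let $T(C)=i$ if $|C\cap D_i|>\frac12|C|$ for some $i\in\{1,\dots,q\}$, and $T(C)=0$ otherwise. A solution $G'$ is standard if for every clique $C'$ of $G'$ and every two distinct cliques $C_1\ne C_2$ of $G$ with $C_1,C_2\subseteq C'$, we have $T(C_1)=T(C_2)>0$. -}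

module Defs where

open import Data.Nat using (ℕ; _*_; _<_; _≤_)
open import Data.Bool using (Bool; true; false; _∧_; _∨_; _xor_; if_then_else_)
open import Data.Fin using (Fin; _≟_; _<?_)
open import Data.Fin.Subset using (Subset; _∩_; ∣_∣; _⊆_)
open import Data.Vec using (tabulate)
open import Data.List using (map; allFin)
open import Data.Nat.ListAction using (sum)
open import Data.Product using (Σ; _×_)
open import Relation.Nullary using (¬_)
open import Relation.Nullary.Decidable using (⌊_⌋)
open import Relation.Binary.PropositionalEquality using (_≡_; _≢_)

record Graph (n : ℕ) : Set where
  field
    adj    : Fin n → Fin n → Bool
    sym    : ∀ i j → adj i j ≡ adj j i
    irrefl : ∀ i → adj i i ≡ false
open Graph public

-- Cluster graph: disjoint union of cliques, i.e. adjacency is transitive on distinct vertices.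
IsCluster : ∀ {n} → Graph n → Set
IsCluster G = ∀ i j k → adj G i j ≡ true → adj G j k ≡ true → i ≢ k → adj G i k ≡ true

EdgeSub : ∀ {n} → Graph n → Graph n → Set
EdgeSub G H = ∀ i j → adj G i j ≡ true → adj H i j ≡ true

edgeDist : ∀ {n} → Graph n → Graph n → ℕ
edgeDist {n} G H =
  sum (map (λ i → sum (map (λ j →
    if ⌊ i <? j ⌋ ∧ (adj G i j xor adj H i j) then 1 else 0) (allFin n))) (allFin n))

-- Closed neighbourhood of v; in a cluster graph these are exactly the cliques
-- (connected components / maximal cliques).
clique : ∀ {n} → Graph n → Fin n → Subset n
clique G v = tabulate (λ u → ⌊ v ≟ u ⌋ ∨ adj G v u)

Majority : ∀ {n} → Subset n → Subset n → Set
Majority C D = ∣ C ∣ < 2 * ∣ C ∩ D ∣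

IsSolution : ∀ {n} → Graph n → Graph n → ℕ → ℕ → Graph n → Set
IsSolution G Gc k d G' =
  IsCluster G' × EdgeSub G G' × edgeDist G G' ≤ k × edgeDist G' Gc ≤ d

YesInstance : ∀ {n} → Graph n → Graph n → ℕ → ℕ → Set
YesInstance {n} G Gc k d = Σ (Graph n) (IsSolution G Gc k d)

-- Standard solution: for every clique C' = clique G' x of G' and distinct cliques
-- C₁ = clique G v, C₂ = clique G w of G contained in C', T(C₁) = T(C₂) > 0, i.e.
-- some clique D = clique Gc u of Gc has a strict majority in both C₁ and C₂
-- (at most one clique of Gc can have a strict majority in a given C).
Standard : ∀ {n} → Graph n → Graph n → Graph n → Set
Standard {n} G Gc G' =
  ∀ (x v w : Fin n) →
    clique G v ⊆ clique G' x → clique G w ⊆ clique G' x →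
    ¬ (clique G v ≡ clique G w) →
    Σ (Fin n) (λ u → Majority (clique G v) (clique Gc u) × Majority (clique G w) (clique Gc u))

module Submission where

-- Start from any solution G′. Two cliques of G have the same type when one
-- clique of Gc holds a strict majority in both (T(C₁) = T(C₂) > 0). Trimming G′
-- keeps an edge only if it lies inside a clique of G or joins two cliques of G
-- of the same type. The trimmed graph is a cluster graph (having the same type
-- is transitive, since a set has at most one majority clique), it lies between
-- G and G′, and it is standard by construction; so only its distance to Gc
-- needs work. Between two cliques X, Y of G the solution G′ is complete or
-- empty, so trimming deletes whole blocks X × Y, and only for X, Y of different
-- types. The cross-bound shows that then at most half of X × Y are edges of Gc,
-- so deleting the block does not increase the distance to Gc.

open import Defs renaming (sym to adj-sym; irrefl to adj-irrefl)
import Data.Nat as ℕ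
open import Data.Nat using (ℕ; zero; suc; _+_; _*_; _≤_; z≤n)
open import Data.Nat.Properties
  using (+-identityʳ; +-mono-≤; +-mono-<; +-monoʳ-≤; +-cancelˡ-≤; +-cancelʳ-≤; +-cancelˡ-<;
         *-distribˡ-+; *-monoʳ-≤; ≤-refl; ≤-trans; ≤-reflexive; <-irrefl; <-≤-trans; <⇒≤; ≮⇒≥;
         m≤m+n; m≤n⇒∃[o]m+o≡n; +-*-semiring; module ≤-Reasoning)
open import Data.Nat.ListAction using () renaming (sum to listSum)
open import Data.Bool using (Bool; true; false; _∧_; _∨_; _xor_; not; if_then_else_)
open import Data.Fin using (Fin; zero; suc; _<?_)
open import Data.Fin.Properties using (_≟_; any?)
import Data.Fin.Properties as Fin
open import Data.Fin.Subset using (Subset; ∣_∣; _∩_; _⊆_)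
open import Data.List using (allFin)
import Data.List as List
open import Data.List.Properties using (map-tabulate)
open import Data.Vec using (_∷_; []; lookup)
open import Data.Vec.Properties
  using (lookup-zipWith; lookup∘tabulate; tabulate-cong; []=⇒lookup; lookup⇒[]=)
open import Data.Maybe using (Maybe; just; nothing; fromMaybe)
import Data.Maybe as Maybe
open import Data.Maybe.Properties using (just-injective)
open import Data.Product using (Σ; ∃; _×_; _,_; proj₁; proj₂)
open import Data.Nat.Tactic.RingSolver using (solve-∀)
open import Data.Bool.Properties
  using (∨-zeroʳ; ∧-zeroʳ; ∧-identityʳ; ∧-inverseʳ; ∧-conicalˡ; ∧-conicalʳ)
open import Data.Empty using (⊥; ⊥-elim)
open import Data.Sum using (_⊎_; inj₁; inj₂)
open import Function using (_∘_)
open import Relation.Nullary using (¬_; Dec; yes; no)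
open import Relation.Nullary.Decidable using (⌊_⌋; ⌊⌋-map′; _×-dec_)
open import Relation.Binary.Definitions using (tri<; tri≈; tri>)
open import Relation.Binary.PropositionalEquality
open import Algebra.Properties.Semiring.Sum +-*-semiring
  using (sum-syntax; sum-cong-≗; ∑-distrib-+; ∑-comm; *-distribˡ-sum; *-distribʳ-sum)

⟦_⟧ : Bool → ℕ
⟦ b ⟧ = if b then 1 else 0

∨-cases : ∀ {a b} → a ∨ b ≡ true → a ≡ true ⊎ b ≡ true
∨-cases {true} _ = inj₁ refl
∨-cases {false} b = inj₂ b

∨-introʳ : ∀ a {b} → b ≡ true → a ∨ b ≡ true
∨-introʳ a refl = ∨-zeroʳ a

bool-ext : ∀ {a b : Bool} → (a ≡ true → b ≡ true) → (b ≡ true → a ≡ true) → a ≡ b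
bool-ext {false} {false} _ _ = refl
bool-ext {false} {true} _ b⇒a = b⇒a refl
bool-ext {true} {false} a⇒b _ = sym (a⇒b refl)
bool-ext {true} {true} _ _ = refl

⌊⌋-sound : ∀ {p} {P : Set p} (d : Dec P) → ⌊ d ⌋ ≡ true → P
⌊⌋-sound (yes p) _ = p

⌊⌋-complete : ∀ {p} {P : Set p} (d : Dec P) → P → ⌊ d ⌋ ≡ true
⌊⌋-complete (yes _) _ = refl
⌊⌋-complete (no ¬p) p = ⊥-elim (¬p p)

∧-split : ∀ a g → ⟦ a ∧ g ⟧ + ⟦ a ∧ not g ⟧ ≡ ⟦ a ⟧
∧-split false g = refl
∧-split true false = refl
∧-split true true = refl

⟦⟧-mono : ∀ a {g h} → (g ≡ true → h ≡ true) → ⟦ a ∧ g ⟧ ≤ ⟦ a ∧ h ⟧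
⟦⟧-mono false _ = z≤n
⟦⟧-mono true {false} _ = z≤n
⟦⟧-mono true {true} g⇒h rewrite g⇒h refl = ≤-refl

contrapositive : ∀ {a b} → (a ≡ true → b ≡ true) → not b ≡ true → not a ≡ true
contrapositive {false} _ _ = refl
contrapositive {true} a⇒b ¬b with () ← trans (sym (cong not (a⇒b refl))) ¬b

listSum-allFin : ∀ {n} (f : Fin n → ℕ) → listSum (List.map f (allFin n)) ≡ ∑[ i < n ] f i
listSum-allFin {zero} f = refl
listSum-allFin {suc n} f =
  cong (f zero +_) (trans (cong listSum tail-map) (listSum-allFin (f ∘ suc)))
  where
  tail-map : List.map f (List.tabulate suc) ≡ List.map (f ∘ suc) (allFin n)
  tail-map = trans (map-tabulate suc f) (sym (map-tabulate (λ i → i) (f ∘ suc)))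

∑-mono : ∀ {n} {f g : Fin n → ℕ} → (∀ i → f i ≤ g i) → ∑[ i < n ] f i ≤ ∑[ i < n ] g i
∑-mono {zero} le = z≤n
∑-mono {suc n} le = +-mono-≤ (le zero) (∑-mono (le ∘ suc))

∑-zero : ∀ {n} {f : Fin n → ℕ} → (∀ i → f i ≡ 0) → ∑[ i < n ] f i ≡ 0
∑-zero {zero} eq = refl
∑-zero {suc n} eq = cong₂ _+_ (eq zero) (∑-zero (eq ∘ suc))

∑-point : ∀ {n} (r : Fin n) (b : Bool) → ∑[ x < n ] ⟦ ⌊ r ≟ x ⌋ ∧ b ⟧ ≡ ⟦ b ⟧
∑-point {suc n} zero b =
  trans (cong (⟦ b ⟧ +_) (∑-zero {n} {λ _ → 0} (λ _ → refl))) (+-identityʳ ⟦ b ⟧)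
∑-point {suc n} (suc r) b =
  trans (sum-cong-≗ (λ x → cong (λ c → ⟦ c ∧ b ⟧) (⌊⌋-map′ _ _ (r ≟ x)))) (∑-point r b)

∑²-distrib-+ : ∀ {n} (f g : Fin n → Fin n → ℕ) →
  ∑[ u < n ] ∑[ v < n ] (f u v + g u v) ≡ ∑[ u < n ] ∑[ v < n ] f u v + ∑[ u < n ] ∑[ v < n ] g u v
∑²-distrib-+ {n} f g = trans (sum-cong-≗ (λ u → ∑-distrib-+ (f u) (g u)))
  (∑-distrib-+ (λ u → ∑[ v < n ] f u v) (λ u → ∑[ v < n ] g u v))

∑⁴-reorder : ∀ {n} (f : Fin n → Fin n → Fin n → Fin n → ℕ) →
  ∑[ u < n ] ∑[ v < n ] ∑[ x < n ] ∑[ y < n ] f u v x y ≡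
  ∑[ x < n ] ∑[ y < n ] ∑[ u < n ] ∑[ v < n ] f u v x y
∑⁴-reorder {n} f = begin
  ∑[ u < n ] ∑[ v < n ] ∑[ x < n ] ∑[ y < n ] f u v x y
    ≡⟨ sum-cong-≗ (λ u → ∑-comm (λ v x → ∑[ y < n ] f u v x y)) ⟩
  ∑[ u < n ] ∑[ x < n ] ∑[ v < n ] ∑[ y < n ] f u v x y
    ≡⟨ ∑-comm (λ u x → ∑[ v < n ] ∑[ y < n ] f u v x y) ⟩
  ∑[ x < n ] ∑[ u < n ] ∑[ v < n ] ∑[ y < n ] f u v x y
    ≡⟨ sum-cong-≗ (λ x → sum-cong-≗ (λ u → ∑-comm (λ v y → f u v x y))) ⟩
  ∑[ x < n ] ∑[ u < n ] ∑[ y < n ] ∑[ v < n ] f u v x y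
    ≡⟨ sum-cong-≗ (λ x → ∑-comm (λ u y → ∑[ v < n ] f u v x y)) ⟩
  ∑[ x < n ] ∑[ y < n ] ∑[ u < n ] ∑[ v < n ] f u v x y ∎
  where open ≡-Reasoning

∑-weighted : ∀ {n} (f g : Fin n → ℕ) (b c : ℕ) →
  ∑[ u < n ] (f u * b + g u * c) ≡ ∑[ u < n ] f u * b + ∑[ u < n ] g u * c
∑-weighted f g b c = trans (∑-distrib-+ (λ u → f u * b) (λ u → g u * c))
  (sym (cong₂ _+_ (*-distribʳ-sum b f) (*-distribʳ-sum c g)))

half-≤ : ∀ {a b} → a + a ≤ b + b → a ≤ b
half-≤ le = ≮⇒≥ (λ b<a → <-irrefl refl (<-≤-trans (+-mono-< b<a b<a) le))

rearrangement : ∀ {a a′ b c} → a ≤ a′ → c ≤ b → a * b + a′ * c ≤ a * c + a′ * b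
rearrangement {a} {a′} {b} {c} a≤a′ c≤b
  with s , refl ← m≤n⇒∃[o]m+o≡n a≤a′ | t , refl ← m≤n⇒∃[o]m+o≡n c≤b =
  subst (a * (c + t) + (a + s) * c ≤_) (expand a s c t) (m≤m+n _ (s * t))
  where
  expand : ∀ a s c t → a * (c + t) + (a + s) * c + s * t ≡ a * c + (a + s) * (c + t)
  expand = solve-∀

-- Bounding a row weighted by ⟦ x ⟧ by case on d (in cross-bound: x is u ∈ X, d is u ∈ D).
row-split-≤ : ∀ x d {p b c} → (d ≡ true → p ≤ b) → (not d ≡ true → p ≤ c) →
  ⟦ x ⟧ * p ≤ ⟦ x ∧ d ⟧ * b + ⟦ x ∧ not d ⟧ * c
row-split-≤ false _ _ _ = z≤n
row-split-≤ true true {b = b} {c} p≤b _ = ≤-trans (*-monoʳ-≤ 1 (p≤b refl)) (m≤m+n (1 * b) (0 * c))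
row-split-≤ true false _ p≤c = *-monoʳ-≤ 1 (p≤c refl)

row-split-≥ : ∀ x d {q b c} → (d ≡ true → c ≤ q) → (not d ≡ true → b ≤ q) →
  ⟦ x ∧ d ⟧ * c + ⟦ x ∧ not d ⟧ * b ≤ ⟦ x ⟧ * q
row-split-≥ false _ _ _ = z≤n
row-split-≥ true true {q} {b} {c} c≤q _ =
  subst (_≤ 1 * q) (sym (+-identityʳ (1 * c))) (*-monoʳ-≤ 1 (c≤q refl))
row-split-≥ true false _ b≤q = *-monoʳ-≤ 1 (b≤q refl)

_∋_ : ∀ {n} → Subset n → Fin n → Bool
s ∋ v = lookup s v

∣∣-as-∑ : ∀ {n} (s : Subset n) → ∣ s ∣ ≡ ∑[ v < n ] ⟦ s ∋ v ⟧
∣∣-as-∑ [] = refl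
∣∣-as-∑ (true ∷ s) = cong suc (∣∣-as-∑ s)
∣∣-as-∑ (false ∷ s) = ∣∣-as-∑ s

∣∩∣-as-∑ : ∀ {n} (s t : Subset n) → ∣ s ∩ t ∣ ≡ ∑[ v < n ] ⟦ s ∋ v ∧ t ∋ v ⟧
∣∩∣-as-∑ s t = trans (∣∣-as-∑ (s ∩ t)) (sum-cong-≗ (λ v → cong ⟦_⟧ (lookup-zipWith _∧_ v s t)))

inside outside : ∀ {n} → Subset n → Subset n → ℕ
inside {n} S D = ∑[ v < n ] ⟦ S ∋ v ∧ D ∋ v ⟧
outside {n} S D = ∑[ v < n ] ⟦ S ∋ v ∧ not (D ∋ v) ⟧

inside+outside : ∀ {n} (S D : Subset n) → inside S D + outside S D ≡ ∣ S ∣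
inside+outside {n} S D = begin
  inside S D + outside S D
    ≡⟨ ∑-distrib-+ (λ v → ⟦ S ∋ v ∧ D ∋ v ⟧) (λ v → ⟦ S ∋ v ∧ not (D ∋ v) ⟧) ⟨
  ∑[ v < n ] (⟦ S ∋ v ∧ D ∋ v ⟧ + ⟦ S ∋ v ∧ not (D ∋ v) ⟧)
    ≡⟨ sum-cong-≗ (λ v → ∧-split (S ∋ v) (D ∋ v)) ⟩
  ∑[ v < n ] ⟦ S ∋ v ⟧
    ≡⟨ ∣∣-as-∑ S ⟨
  ∣ S ∣ ∎
  where open ≡-Reasoning

∣∩∣-disjoint : ∀ {n} (C s t : Subset n) → (∀ w → s ∋ w ≡ true → t ∋ w ≡ true → ⊥) →
  ∣ C ∩ s ∣ + ∣ C ∩ t ∣ ≤ ∣ C ∣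
∣∩∣-disjoint C s t disjoint = begin
  ∣ C ∩ s ∣ + ∣ C ∩ t ∣    ≡⟨ cong₂ _+_ (∣∩∣-as-∑ C s) (∣∩∣-as-∑ C t) ⟩
  inside C s + inside C t  ≤⟨ +-monoʳ-≤ (inside C s) (∑-mono (λ w → ⟦⟧-mono (C ∋ w) (t⇒¬s w))) ⟩
  inside C s + outside C s ≡⟨ inside+outside C s ⟩
  ∣ C ∣                    ∎
  where
  open ≤-Reasoning
  t⇒¬s : ∀ w → t ∋ w ≡ true → not (s ∋ w) ≡ true
  t⇒¬s w t∋w with s ∋ w in s∋w
  ... | true = ⊥-elim (disjoint w s∋w t∋w)
  ... | false = refl

minority : ∀ {n} (S D : Subset n) → ¬ Majority S D → inside S D ≤ outside S D
minority S D not-maj = +-cancelˡ-≤ (inside S D) _ _ (begin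
  inside S D + inside S D       ≡⟨ cong (inside S D +_) (+-identityʳ (inside S D)) ⟨
  2 * inside S D                ≡⟨ cong (2 *_) (∣∩∣-as-∑ S D) ⟨
  2 * ∣ S ∩ D ∣                 ≤⟨ ≮⇒≥ not-maj ⟩
  ∣ S ∣                         ≡⟨ inside+outside S D ⟨
  inside S D + outside S D      ∎)
  where open ≤-Reasoning

majority : ∀ {n} (S D : Subset n) → Majority S D → outside S D ≤ inside S D
majority S D maj = <⇒≤ (+-cancelˡ-< (inside S D) _ _ (begin-strict
  inside S D + outside S D      ≡⟨ inside+outside S D ⟩
  ∣ S ∣                         <⟨ maj ⟩
  2 * ∣ S ∩ D ∣                 ≡⟨ cong (2 *_) (∣∩∣-as-∑ S D) ⟩
  2 * inside S D                ≡⟨ cong (inside S D +_) (+-identityʳ (inside S D)) ⟩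
  inside S D + inside S D       ∎))
  where open ≤-Reasoning

majority? : ∀ {n} (S D : Subset n) → Dec (Majority S D)
majority? S D = ∣ S ∣ ℕ.<? 2 * ∣ S ∩ D ∣

pairs : ∀ {n} → (Fin n → Fin n → Bool) → ℕ
pairs {n} R = ∑[ u < n ] ∑[ v < n ] ⟦ R u v ⟧

risingPairs : ∀ {n} → (Fin n → Fin n → Bool) → ℕ
risingPairs {n} R = ∑[ u < n ] ∑[ v < n ] ⟦ ⌊ u <? v ⌋ ∧ R u v ⟧

edgeDist-as-risingPairs : ∀ {n} (G H : Graph n) →
  edgeDist G H ≡ risingPairs (λ u v → adj G u v xor adj H u v)
edgeDist-as-risingPairs {n} G H =
  trans (listSum-allFin (λ u → listSum (List.map (f u) (allFin n))))
        (sum-cong-≗ (λ u → listSum-allFin (f u)))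
  where
  f : Fin n → Fin n → ℕ
  f u v = ⟦ ⌊ u <? v ⌋ ∧ (adj G u v xor adj H u v) ⟧

pairs-symmetric : ∀ {n} (R : Fin n → Fin n → Bool) →
  (∀ u v → R u v ≡ R v u) → (∀ u → R u u ≡ false) →
  pairs R ≡ risingPairs R + risingPairs R
pairs-symmetric {n} R sym-R irrefl-R = begin
  pairs R
    ≡⟨ sum-cong-≗ (λ u → sum-cong-≗ (split u)) ⟩
  ∑[ u < n ] ∑[ v < n ] (⟦ ⌊ u <? v ⌋ ∧ R u v ⟧ + ⟦ ⌊ v <? u ⌋ ∧ R v u ⟧)
    ≡⟨ ∑²-distrib-+ (λ u v → ⟦ ⌊ u <? v ⌋ ∧ R u v ⟧) (λ u v → ⟦ ⌊ v <? u ⌋ ∧ R v u ⟧) ⟩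
  risingPairs R + ∑[ u < n ] ∑[ v < n ] ⟦ ⌊ v <? u ⌋ ∧ R v u ⟧
    ≡⟨ cong (risingPairs R +_) (∑-comm (λ u v → ⟦ ⌊ v <? u ⌋ ∧ R v u ⟧)) ⟩
  risingPairs R + risingPairs R ∎
  where
  open ≡-Reasoning
  split : ∀ u v → ⟦ R u v ⟧ ≡ ⟦ ⌊ u <? v ⌋ ∧ R u v ⟧ + ⟦ ⌊ v <? u ⌋ ∧ R v u ⟧
  split u v with u <? v | v <? u
  ... | yes u<v | yes v<u = ⊥-elim (Fin.<-asym u<v v<u)
  ... | yes _   | no _    = sym (+-identityʳ _)
  ... | no _    | yes _   = cong ⟦_⟧ (sym-R u v)
  ... | no u≮v  | no v≮u with Fin.<-cmp u v
  ...   | tri< u<v _ _ = ⊥-elim (u≮v u<v)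
  ...   | tri> _ _ v<u = ⊥-elim (v≮u v<u)
  ...   | tri≈ _ refl _ = cong ⟦_⟧ (irrefl-R u)

xor-mono : ∀ c {g h k} → (g ≡ true → h ≡ true) → (h ≡ true → k ≡ true) →
  ⟦ c ∧ (g xor h) ⟧ ≤ ⟦ c ∧ (g xor k) ⟧
xor-mono false _ _ = z≤n
xor-mono true {false} {false} _ _ = z≤n
xor-mono true {false} {true} {true} _ _ = ≤-refl
xor-mono true {false} {true} {false} _ h⇒k with () ← h⇒k refl
xor-mono true {true} {true} _ _ = z≤n
xor-mono true {true} {false} g⇒h _ with () ← g⇒h refl

edgeDist-mono : ∀ {n} (G H K : Graph n) → EdgeSub G H → EdgeSub H K →
  edgeDist G H ≤ edgeDist G K
edgeDist-mono G H K G⊆H H⊆K = begin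
  edgeDist G H
    ≡⟨ edgeDist-as-risingPairs G H ⟩
  risingPairs (λ u v → adj G u v xor adj H u v)
    ≤⟨ ∑-mono (λ u → ∑-mono (λ v → xor-mono ⌊ u <? v ⌋ (G⊆H u v) (H⊆K u v))) ⟩
  risingPairs (λ u v → adj G u v xor adj K u v)
    ≡⟨ edgeDist-as-risingPairs G K ⟨
  edgeDist G K ∎
  where open ≤-Reasoning

missing : ∀ {n} → Graph n → Graph n → Fin n → Fin n → Bool
missing H K u v = adj K u v ∧ not (adj H u v)

xor-deletion : ∀ c {h k} g → (h ≡ true → k ≡ true) →
  ⟦ c ∧ (h xor g) ⟧ + ⟦ c ∧ ((k ∧ not h) ∧ not g) ⟧ ≡ ⟦ c ∧ (k xor g) ⟧ + ⟦ c ∧ ((k ∧ not h) ∧ g) ⟧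
xor-deletion false g _ = refl
xor-deletion true {true} {true} g _ = refl
xor-deletion true {true} {false} g h⇒k with () ← h⇒k refl
xor-deletion true {false} {false} g _ = refl
xor-deletion true {false} {true} true _ = refl
xor-deletion true {false} {true} false _ = refl

-- Passing from K to a subgraph H trades the missing edges lying in Gc
-- (which H now gets wrong) for those lying outside Gc (which H gets right).
deletion-balance : ∀ {n} (H K Gc : Graph n) → EdgeSub H K →
  edgeDist H Gc + risingPairs (λ u v → missing H K u v ∧ not (adj Gc u v)) ≡
  edgeDist K Gc + risingPairs (λ u v → missing H K u v ∧ adj Gc u v)
deletion-balance {n} H K Gc H⊆K = begin
  edgeDist H Gc + risingPairs outGc
    ≡⟨ cong (_+ risingPairs outGc) (edgeDist-as-risingPairs H Gc) ⟩
  risingPairs (λ u v → adj H u v xor adj Gc u v) + risingPairs outGc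
    ≡⟨ ∑²-distrib-+ (λ u v → ⟦ ⌊ u <? v ⌋ ∧ (adj H u v xor adj Gc u v) ⟧)
                    (λ u v → ⟦ ⌊ u <? v ⌋ ∧ outGc u v ⟧) ⟨
  ∑[ u < n ] ∑[ v < n ] (⟦ ⌊ u <? v ⌋ ∧ (adj H u v xor adj Gc u v) ⟧ + ⟦ ⌊ u <? v ⌋ ∧ outGc u v ⟧)
    ≡⟨ sum-cong-≗ (λ u → sum-cong-≗ (λ v → xor-deletion ⌊ u <? v ⌋ (adj Gc u v) (H⊆K u v))) ⟩
  ∑[ u < n ] ∑[ v < n ] (⟦ ⌊ u <? v ⌋ ∧ (adj K u v xor adj Gc u v) ⟧ + ⟦ ⌊ u <? v ⌋ ∧ inGc u v ⟧)
    ≡⟨ ∑²-distrib-+ (λ u v → ⟦ ⌊ u <? v ⌋ ∧ (adj K u v xor adj Gc u v) ⟧)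
                    (λ u v → ⟦ ⌊ u <? v ⌋ ∧ inGc u v ⟧) ⟩
  risingPairs (λ u v → adj K u v xor adj Gc u v) + risingPairs inGc
    ≡⟨ cong (_+ risingPairs inGc) (edgeDist-as-risingPairs K Gc) ⟨
  edgeDist K Gc + risingPairs inGc ∎
  where
  open ≡-Reasoning
  inGc outGc : Fin n → Fin n → Bool
  inGc u v = missing H K u v ∧ adj Gc u v
  outGc u v = missing H K u v ∧ not (adj Gc u v)

missing-sym : ∀ {n} (H K Gc : Graph n) (g : Bool → Bool) u v →
  (missing H K u v ∧ g (adj Gc u v)) ≡ (missing H K v u ∧ g (adj Gc v u))
missing-sym H K Gc g u v =
  cong₂ _∧_ (cong₂ (λ k h → k ∧ not h) (adj-sym K u v) (adj-sym H u v)) (cong g (adj-sym Gc u v))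

missing-irrefl : ∀ {n} (H K Gc : Graph n) (g : Bool → Bool) u →
  (missing H K u u ∧ g (adj Gc u u)) ≡ false
missing-irrefl H K Gc g u = cong (λ k → (k ∧ not (adj H u u)) ∧ g (adj Gc u u)) (adj-irrefl K u)

edgeDist-deletion : ∀ {n} (H K Gc : Graph n) → EdgeSub H K →
  pairs (λ u v → missing H K u v ∧ adj Gc u v) ≤
  pairs (λ u v → missing H K u v ∧ not (adj Gc u v)) →
  edgeDist H Gc ≤ edgeDist K Gc
edgeDist-deletion H K Gc H⊆K fewer =
  +-cancelʳ-≤ outGc (edgeDist H Gc) (edgeDist K Gc)
    (subst (_≤ edgeDist K Gc + outGc) (sym (deletion-balance H K Gc H⊆K))
      (+-monoʳ-≤ (edgeDist K Gc) inGc≤outGc))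
  where
  inGc outGc : ℕ
  inGc = risingPairs (λ u v → missing H K u v ∧ adj Gc u v)
  outGc = risingPairs (λ u v → missing H K u v ∧ not (adj Gc u v))
  inGc≤outGc : inGc ≤ outGc
  inGc≤outGc = half-≤ (subst₂ _≤_
    (pairs-symmetric _ (missing-sym H K Gc (λ c → c)) (missing-irrefl H K Gc (λ c → c)))
    (pairs-symmetric _ (missing-sym H K Gc not) (missing-irrefl H K Gc not))
    fewer)

-- u and v lie in a common clique of H (when H is a cluster graph):
-- they are equal or adjacent.
data Near {n} (H : Graph n) (u : Fin n) : Fin n → Set where
  here : Near H u u
  edge : ∀ {v} → adj H u v ≡ true → Near H u v

module _ {n} {H : Graph n} where

  ∋⇒Near : ∀ {u v} → clique H u ∋ v ≡ true → Near H u v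
  ∋⇒Near {u} {v} eq = near (u ≟ v) (trans (sym (lookup∘tabulate _ v)) eq)
    where
    near : (d : Dec (u ≡ v)) → (⌊ d ⌋ ∨ adj H u v) ≡ true → Near H u v
    near (yes refl) _ = here
    near (no _) uv = edge uv

  Near⇒∋ : ∀ {u v} → Near H u v → clique H u ∋ v ≡ true
  Near⇒∋ {u} here = trans (lookup∘tabulate _ u) (cong (_∨ adj H u u) (⌊⌋-complete (u ≟ u) refl))
  Near⇒∋ {u} {v} (edge uv) =
    trans (lookup∘tabulate _ v) (trans (cong (⌊ u ≟ v ⌋ ∨_) uv) (∨-zeroʳ ⌊ u ≟ v ⌋))

  ∌⇒¬Near : ∀ {u v} → clique H u ∋ v ≡ false → ¬ Near H u v
  ∌⇒¬Near u∌v uv with () ← trans (sym u∌v) (Near⇒∋ uv)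

  Near-sym : ∀ {u v} → Near H u v → Near H v u
  Near-sym here = here
  Near-sym {u} {v} (edge uv) = edge (trans (adj-sym H v u) uv)

  Near⇒adj : ∀ {u v} → Near H u v → u ≢ v → adj H u v ≡ true
  Near⇒adj here u≢u = ⊥-elim (u≢u refl)
  Near⇒adj (edge uv) _ = uv

  Near-mono : ∀ {K : Graph n} → EdgeSub H K → ∀ {u v} → Near H u v → Near K u v
  Near-mono H⊆K here = here
  Near-mono H⊆K {u} {v} (edge uv) = edge (H⊆K u v uv)

  module _ (cluster : IsCluster H) where

    Near-trans : ∀ {a b c} → Near H a b → Near H b c → Near H a c
    Near-trans here bc = bc
    Near-trans ab here = ab
    Near-trans {a} {b} {c} (edge ab) (edge bc) with a ≟ c
    ... | yes refl = here
    ... | no a≢c = edge (cluster a b c ab bc a≢c)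

    clique-cong : ∀ {u v} → Near H u v → clique H u ≡ clique H v
    clique-cong {u} {v} uv = tabulate-cong (λ w → begin
      ⌊ u ≟ w ⌋ ∨ adj H u w    ≡⟨ lookup∘tabulate _ w ⟨
      clique H u ∋ w           ≡⟨ bool-ext (λ p → Near⇒∋ (Near-trans (Near-sym uv) (∋⇒Near p)))
                                           (λ p → Near⇒∋ (Near-trans uv (∋⇒Near p))) ⟩
      clique H v ∋ w           ≡⟨ lookup∘tabulate _ w ⟩
      ⌊ v ≟ w ⌋ ∨ adj H v w    ∎)
      where open ≡-Reasoning

    clique-disjoint : ∀ {u v w} → clique H u ∋ v ≡ false →
      clique H u ∋ w ≡ true → clique H v ∋ w ≡ true → ⊥
    clique-disjoint u∌v u∋w v∋w = ∌⇒¬Near u∌v (Near-trans (∋⇒Near u∋w) (Near-sym (∋⇒Near v∋w)))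

majority-unique : ∀ {n} {H : Graph n} → IsCluster H → ∀ (C : Subset n) {i j} →
  Majority C (clique H i) → Majority C (clique H j) → clique H i ≡ clique H j
majority-unique {H = H} cluster C {i} {j} maj-i maj-j with clique H i ∋ j in i∋j
... | true = clique-cong {H = H} cluster (∋⇒Near i∋j)
... | false = ⊥-elim (<-irrefl refl (<-≤-trans (+-mono-< maj-i maj-j) doubled))
  where
  a b : ℕ
  a = ∣ C ∩ clique H i ∣
  b = ∣ C ∩ clique H j ∣
  a+b≤∣C∣ : a + b ≤ ∣ C ∣
  a+b≤∣C∣ = ∣∩∣-disjoint C (clique H i) (clique H j) (λ w → clique-disjoint {H = H} cluster i∋j)
  doubled : 2 * a + 2 * b ≤ ∣ C ∣ + ∣ C ∣
  doubled = subst₂ _≤_ (*-distribˡ-+ 2 a b) (cong (∣ C ∣ +_) (+-identityʳ ∣ C ∣))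
    (*-monoʳ-≤ 2 a+b≤∣C∣)

missing-Near : ∀ {n} {G : Graph n} (H K : Graph n) → EdgeSub G H → ∀ {u v} → Near G u v →
  missing H K u v ≡ false
missing-Near H K G⊆H {u} here = cong (λ k → k ∧ not (adj H u u)) (adj-irrefl K u)
missing-Near H K G⊆H {u} {v} (edge uv) =
  trans (cong (λ h → adj K u v ∧ not h) (G⊆H u v uv)) (∧-zeroʳ (adj K u v))

between-cliques : ∀ {n} (G G′ : Graph n) → IsCluster G → IsCluster G′ → EdgeSub G G′ →
  ∀ {x y u v} → ¬ Near G x y → Near G x u → Near G y v → adj G′ u v ≡ adj G′ x y
between-cliques G G′ cluster cluster′ G⊆G′ {x} {y} {u} {v} far xu yv = bool-ext
  (λ uv → Near⇒adj (trans′ (trans′ (lift xu) (edge uv)) (lift (Near-sym yv))) x≢y)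
  (λ xy → Near⇒adj (trans′ (trans′ (lift (Near-sym xu)) (edge xy)) (lift yv)) u≢v)
  where
  trans′ : ∀ {a b c} → Near G′ a b → Near G′ b c → Near G′ a c
  trans′ = Near-trans cluster′
  lift : ∀ {a b} → Near G a b → Near G′ a b
  lift = Near-mono G⊆G′
  x≢y : x ≢ y
  x≢y refl = far here
  u≢v : u ≢ v
  u≢v refl = far (Near-trans cluster xu (Near-sym yv))

block : ∀ {n} → Subset n → Subset n → (Fin n → Fin n → Bool) → ℕ
block {n} X Y R = ∑[ u < n ] ∑[ v < n ] ⟦ X ∋ u ∧ (Y ∋ v ∧ R u v) ⟧

block-cong : ∀ {n} (X Y : Subset n) {R S : Fin n → Fin n → Bool} →
  (∀ {u v} → X ∋ u ≡ true → Y ∋ v ≡ true → R u v ≡ S u v) → block X Y R ≡ block X Y S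
block-cong {n} X Y {R} {S} R≗S = sum-cong-≗ (λ u → sum-cong-≗ (λ v → pointwise u v))
  where
  pointwise : ∀ u v → ⟦ X ∋ u ∧ (Y ∋ v ∧ R u v) ⟧ ≡ ⟦ X ∋ u ∧ (Y ∋ v ∧ S u v) ⟧
  pointwise u v with X ∋ u in x∋u | Y ∋ v in y∋v
  ... | false | _ = refl
  ... | true | false = refl
  ... | true | true = cong ⟦_⟧ (R≗S x∋u y∋v)

block-empty : ∀ {n} (X Y : Subset n) → block X Y (λ _ _ → false) ≡ 0
block-empty X Y = ∑-zero (λ u → ∑-zero (λ v → cong ⟦_⟧
  (trans (cong (X ∋ u ∧_) (∧-zeroʳ (Y ∋ v))) (∧-zeroʳ (X ∋ u)))))

block-by-rows : ∀ {n} (X Y : Subset n) (R : Fin n → Fin n → Bool) →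
  block X Y R ≡ ∑[ u < n ] (⟦ X ∋ u ⟧ * ∑[ v < n ] ⟦ Y ∋ v ∧ R u v ⟧)
block-by-rows {n} X Y R = sum-cong-≗ row
  where
  row : ∀ u → ∑[ v < n ] ⟦ X ∋ u ∧ (Y ∋ v ∧ R u v) ⟧ ≡ ⟦ X ∋ u ⟧ * ∑[ v < n ] ⟦ Y ∋ v ∧ R u v ⟧
  row u with X ∋ u
  ... | true = sym (+-identityʳ _)
  ... | false = ∑-zero {n} {λ _ → 0} (λ _ → refl)

least : ∀ {n} → Subset n → Maybe (Fin n)
least [] = nothing
least (true ∷ s) = just zero
least (false ∷ s) = Maybe.map suc (least s)

least-∈ : ∀ {n} (s : Subset n) {i} → least s ≡ just i → s ∋ i ≡ true
least-∈ (true ∷ s) refl = refl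
least-∈ (false ∷ s) eq with least s in eq′
least-∈ (false ∷ s) refl | just j = least-∈ s eq′

least-exists : ∀ {n} (s : Subset n) i → s ∋ i ≡ true → ∃ λ j → least s ≡ just j
least-exists (true ∷ s) i _ = zero , refl
least-exists (false ∷ s) (suc i) s∋i with least-exists s i s∋i
... | j , eq = suc j , cong (Maybe.map suc) eq

-- Every clique of a cluster graph G is represented by its least vertex, its
-- leader; the blocks clique x × clique y with x, y leaders partition the
-- ordered pairs of vertices, so pairs can be counted block by block.
module Blocks {n} (G : Graph n) (cluster : IsCluster G) where

  leader : Fin n → Fin n
  leader u = fromMaybe u (least (clique G u))

  isLeader : Fin n → Bool
  isLeader x = ⌊ leader x ≟ x ⌋

  leader-least : ∀ u → least (clique G u) ≡ just (leader u)
  leader-least u with least-exists (clique G u) u (Near⇒∋ {H = G} here)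
  ... | j , eq rewrite eq = refl

  leader-Near : ∀ u → Near G u (leader u)
  leader-Near u = ∋⇒Near (least-∈ (clique G u) (leader-least u))

  leader-cong : ∀ {u v} → Near G u v → leader u ≡ leader v
  leader-cong {u} {v} uv = just-injective (begin
    just (leader u)          ≡⟨ leader-least u ⟨
    least (clique G u)       ≡⟨ cong least (clique-cong cluster uv) ⟩
    least (clique G v)       ≡⟨ leader-least v ⟩
    just (leader v)          ∎)
    where open ≡-Reasoning

  led-by : ∀ u x → ⌊ leader u ≟ x ⌋ ≡ isLeader x ∧ clique G x ∋ u
  led-by u x = bool-ext to from
    where
    to : ⌊ leader u ≟ x ⌋ ≡ true → (isLeader x ∧ clique G x ∋ u) ≡ true
    to eq with refl ← ⌊⌋-sound (leader u ≟ x) eq = cong₂ _∧_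
      (⌊⌋-complete (leader x ≟ x) (leader-cong (Near-sym (leader-Near u))))
      (Near⇒∋ (Near-sym (leader-Near u)))
    from : (isLeader x ∧ clique G x ∋ u) ≡ true → ⌊ leader u ≟ x ⌋ ≡ true
    from eq = ⌊⌋-complete (leader u ≟ x)
      (trans (leader-cong (Near-sym (∋⇒Near x∋u))) (⌊⌋-sound (leader x ≟ x) x-leads))
      where
      x-leads : isLeader x ≡ true
      x-leads = ∧-conicalˡ _ _ eq
      x∋u : clique G x ∋ u ≡ true
      x∋u = ∧-conicalʳ _ _ eq

  -- Each ordered pair (u, v) lies in exactly one block clique x × clique y of leaders.
  pairs-by-blocks : ∀ (R : Fin n → Fin n → Bool) →
    pairs R ≡
    ∑[ x < n ] ∑[ y < n ] (⟦ isLeader x ∧ isLeader y ⟧ * block (clique G x) (clique G y) R)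
  pairs-by-blocks R = begin
    ∑[ u < n ] ∑[ v < n ] ⟦ R u v ⟧
      ≡⟨ sum-cong-≗ (λ u → sum-cong-≗ (λ v → split-by-leaders u v)) ⟩
    ∑[ u < n ] ∑[ v < n ] ∑[ x < n ] ∑[ y < n ] ⟦ led v y ∧ (led u x ∧ R u v) ⟧
      ≡⟨ ∑⁴-reorder (λ u v x y → ⟦ led v y ∧ (led u x ∧ R u v) ⟧) ⟩
    ∑[ x < n ] ∑[ y < n ] ∑[ u < n ] ∑[ v < n ] ⟦ led v y ∧ (led u x ∧ R u v) ⟧
      ≡⟨ sum-cong-≗ (λ x → sum-cong-≗ (λ y → factor-leaders x y)) ⟩
    ∑[ x < n ] ∑[ y < n ] (⟦ isLeader x ∧ isLeader y ⟧ * block (clique G x) (clique G y) R) ∎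
    where
    open ≡-Reasoning
    led : Fin n → Fin n → Bool
    led u x = ⌊ leader u ≟ x ⌋

    split-by-leaders : ∀ u v → ⟦ R u v ⟧ ≡ ∑[ x < n ] ∑[ y < n ] ⟦ led v y ∧ (led u x ∧ R u v) ⟧
    split-by-leaders u v = sym (trans
      (sum-cong-≗ (λ x → ∑-point (leader v) (led u x ∧ R u v)))
      (∑-point (leader u) (R u v)))

    factor : ∀ a b c d r → ⟦ (a ∧ b) ∧ ((c ∧ d) ∧ r) ⟧ ≡ ⟦ c ∧ a ⟧ * ⟦ d ∧ (b ∧ r) ⟧
    factor a b false d r = cong ⟦_⟧ (∧-zeroʳ (a ∧ b))
    factor false b true d r = refl
    factor true true true d r = sym (+-identityʳ _)
    factor true false true d r = sym (trans (+-identityʳ _) (cong ⟦_⟧ (∧-zeroʳ d)))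

    factor-leaders : ∀ x y →
      ∑[ u < n ] ∑[ v < n ] ⟦ led v y ∧ (led u x ∧ R u v) ⟧ ≡
      ⟦ isLeader x ∧ isLeader y ⟧ * block (clique G x) (clique G y) R
    factor-leaders x y = begin
      ∑[ u < n ] ∑[ v < n ] ⟦ led v y ∧ (led u x ∧ R u v) ⟧
        ≡⟨ sum-cong-≗ (λ u → sum-cong-≗ (λ v →
             cong₂ (λ p q → ⟦ p ∧ (q ∧ R u v) ⟧) (led-by v y) (led-by u x))) ⟩
      ∑[ u < n ] ∑[ v < n ] ⟦ (isLeader y ∧ Y ∋ v) ∧ ((isLeader x ∧ X ∋ u) ∧ R u v) ⟧
        ≡⟨ sum-cong-≗ (λ u → sum-cong-≗ (λ v →
             factor (isLeader y) (Y ∋ v) (isLeader x) (X ∋ u) (R u v))) ⟩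
      ∑[ u < n ] ∑[ v < n ] (k * ⟦ X ∋ u ∧ (Y ∋ v ∧ R u v) ⟧)
        ≡⟨ sum-cong-≗ (λ u → *-distribˡ-sum k (λ v → ⟦ X ∋ u ∧ (Y ∋ v ∧ R u v) ⟧)) ⟨
      ∑[ u < n ] (k * ∑[ v < n ] ⟦ X ∋ u ∧ (Y ∋ v ∧ R u v) ⟧)
        ≡⟨ *-distribˡ-sum k (λ u → ∑[ v < n ] ⟦ X ∋ u ∧ (Y ∋ v ∧ R u v) ⟧) ⟨
      k * block X Y R ∎
      where
      X Y : Subset n
      X = clique G x
      Y = clique G y
      k : ℕ
      k = ⟦ isLeader x ∧ isLeader y ⟧

  pairs-mono-by-blocks : ∀ (R S : Fin n → Fin n → Bool) →
    (∀ x y → block (clique G x) (clique G y) R ≤ block (clique G x) (clique G y) S) →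
    pairs R ≤ pairs S
  pairs-mono-by-blocks R S blockwise =
    subst₂ _≤_ (sym (pairs-by-blocks R)) (sym (pairs-by-blocks S))
    (∑-mono (λ x → ∑-mono (λ y → *-monoʳ-≤ ⟦ isLeader x ∧ isLeader y ⟧ (blockwise x y))))

neighbours nonNeighbours : ∀ {n} → Graph n → Subset n → Fin n → ℕ
neighbours {n} H Y u = ∑[ v < n ] ⟦ Y ∋ v ∧ adj H u v ⟧
nonNeighbours {n} H Y u = ∑[ v < n ] ⟦ Y ∋ v ∧ not (adj H u v) ⟧

-- In a cluster graph a vertex u sees only its own clique D = clique H j:
-- if u ∈ D its neighbours in Y lie in D, otherwise they lie outside D.
module Rows {n} {H : Graph n} (cluster : IsCluster H) (Y : Subset n) (j : Fin n) where

  D : Subset n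
  D = clique H j

  adj-inside : ∀ {u v} → D ∋ u ≡ true → adj H u v ≡ true → D ∋ v ≡ true
  adj-inside ju uv = Near⇒∋ (Near-trans cluster (∋⇒Near {H = H} ju) (edge uv))

  adj-back : ∀ {u v} → D ∋ v ≡ true → adj H u v ≡ true → D ∋ u ≡ true
  adj-back {u} {v} jv uv = adj-inside jv (trans (adj-sym H v u) uv)

  member-row : ∀ {u} → D ∋ u ≡ true →
    neighbours H Y u ≤ inside Y D × outside Y D ≤ nonNeighbours H Y u
  member-row ju = ∑-mono (λ v → ⟦⟧-mono (Y ∋ v) (adj-inside ju))
                , ∑-mono (λ v → ⟦⟧-mono (Y ∋ v) (contrapositive (adj-inside ju)))

  stranger-row : ∀ {u} → not (D ∋ u) ≡ true →
    neighbours H Y u ≤ outside Y D × inside Y D ≤ nonNeighbours H Y u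
  stranger-row ¬ju =
      ∑-mono (λ v → ⟦⟧-mono (Y ∋ v) (λ uv → contrapositive (λ jv → adj-back jv uv) ¬ju))
    , ∑-mono (λ v → ⟦⟧-mono (Y ∋ v) (λ jv → contrapositive (adj-back jv) ¬ju))

cross-bound : ∀ {n} {H : Graph n} → IsCluster H → (X Y : Subset n) →
  (∀ j → ¬ (Majority X (clique H j) × Majority Y (clique H j))) →
  block X Y (adj H) ≤ block X Y (λ u v → not (adj H u v))
cross-bound {n} {H} cluster X Y no-common with any? (λ j → majority? Y (clique H j))
-- No clique of H holds a majority in Y: every row is balanced by itself.
... | no none = subst₂ _≤_ (sym (block-by-rows X Y (adj H))) (sym (block-by-rows X Y _))
  (∑-mono (λ u → *-monoʳ-≤ ⟦ X ∋ u ⟧ (balanced-row u)))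
  where
  balanced-row : ∀ u → neighbours H Y u ≤ nonNeighbours H Y u
  balanced-row u with p≤in , out≤q ← Rows.member-row {H = H} cluster Y u (Near⇒∋ {H = H} here) =
    ≤-trans p≤in (≤-trans (minority Y (clique H u) (λ maj → none (u , maj))) out≤q)
-- Y has a majority clique D, which X lacks: rows u ∈ D see at most the b members
-- of Y in D, rows u ∉ D at most the c members outside D, and rearrangement
-- compares these weights with the non-neighbours.
... | yes (j , maj-Y) = begin
  block X Y (adj H)
    ≡⟨ block-by-rows X Y (adj H) ⟩
  ∑[ u < n ] (⟦ X ∋ u ⟧ * neighbours H Y u)
    ≤⟨ ∑-mono (λ u → row-split-≤ (X ∋ u) (D ∋ u) (proj₁ ∘ member-row) (proj₁ ∘ stranger-row)) ⟩
  ∑[ u < n ] (⟦ X ∋ u ∧ D ∋ u ⟧ * b + ⟦ X ∋ u ∧ not (D ∋ u) ⟧ * c)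
    ≡⟨ ∑-weighted (λ u → ⟦ X ∋ u ∧ D ∋ u ⟧) (λ u → ⟦ X ∋ u ∧ not (D ∋ u) ⟧) b c ⟩
  a * b + a′ * c
    ≤⟨ rearrangement (minority X D (λ maj-X → no-common j (maj-X , maj-Y))) (majority Y D maj-Y) ⟩
  a * c + a′ * b
    ≡⟨ ∑-weighted (λ u → ⟦ X ∋ u ∧ D ∋ u ⟧) (λ u → ⟦ X ∋ u ∧ not (D ∋ u) ⟧) c b ⟨
  ∑[ u < n ] (⟦ X ∋ u ∧ D ∋ u ⟧ * c + ⟦ X ∋ u ∧ not (D ∋ u) ⟧ * b)
    ≤⟨ ∑-mono (λ u → row-split-≥ (X ∋ u) (D ∋ u) (proj₂ ∘ member-row) (proj₂ ∘ stranger-row)) ⟩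
  ∑[ u < n ] (⟦ X ∋ u ⟧ * nonNeighbours H Y u)
    ≡⟨ block-by-rows X Y (λ u v → not (adj H u v)) ⟨
  block X Y (λ u v → not (adj H u v)) ∎
  where
  open ≤-Reasoning
  open Rows {H = H} cluster Y j
  a a′ b c : ℕ
  a = inside X D
  a′ = outside X D
  b = inside Y D
  c = outside Y D

-- Two sets have the same type when some clique of Gc holds a strict majority
-- in both, i.e. T(C₁) = T(C₂) > 0.
SameType : ∀ {n} → Graph n → Subset n → Subset n → Set
SameType {n} Gc C₁ C₂ = Σ (Fin n) λ j → Majority C₁ (clique Gc j) × Majority C₂ (clique Gc j)

sameType? : ∀ {n} (Gc : Graph n) (C₁ C₂ : Subset n) → Dec (SameType Gc C₁ C₂)
sameType? Gc C₁ C₂ = any? (λ j → majority? C₁ (clique Gc j) ×-dec majority? C₂ (clique Gc j))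

sameType : ∀ {n} → Graph n → Subset n → Subset n → Bool
sameType Gc C₁ C₂ = ⌊ sameType? Gc C₁ C₂ ⌋

SameType-sym : ∀ {n} {Gc : Graph n} {C₁ C₂} → SameType Gc C₁ C₂ → SameType Gc C₂ C₁
SameType-sym (j , maj₁ , maj₂) = j , maj₂ , maj₁

-- Having the same type is transitive because majority cliques are unique.
SameType-trans : ∀ {n} {Gc : Graph n} → IsCluster Gc → ∀ {C₁ C₂ C₃} →
  SameType Gc C₁ C₂ → SameType Gc C₂ C₃ → SameType Gc C₁ C₃
SameType-trans {Gc = Gc} cluster {C₂ = C₂} {C₃} (i , maj₁ , maj₂) (j , maj₂′ , maj₃) =
  i , maj₁ , subst (Majority C₃) (sym (majority-unique {H = Gc} cluster C₂ maj₂ maj₂′)) maj₃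

sameType-sym : ∀ {n} (Gc : Graph n) (C₁ C₂ : Subset n) → sameType Gc C₁ C₂ ≡ sameType Gc C₂ C₁
sameType-sym Gc C₁ C₂ = bool-ext (flip C₁ C₂) (flip C₂ C₁)
  where
  flip : ∀ D₁ D₂ → sameType Gc D₁ D₂ ≡ true → sameType Gc D₂ D₁ ≡ true
  flip D₁ D₂ s = ⌊⌋-complete (sameType? Gc D₂ D₁)
    (SameType-sym {Gc = Gc} {D₁} {D₂} (⌊⌋-sound (sameType? Gc D₁ D₂) s))

module Trimming {n} (G Gc G′ : Graph n) (cluster-G : IsCluster G) (cluster-Gc : IsCluster Gc)
                (cluster-G′ : IsCluster G′) (G⊆G′ : EdgeSub G G′) where

  C : Fin n → Subset n
  C = clique G

  near : ∀ {x u} → C x ∋ u ≡ true → Near G x u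
  near = ∋⇒Near {H = G}

  compatible : Fin n → Fin n → Bool
  compatible u v = adj G u v ∨ sameType Gc (C u) (C v)

  compatible-trans : ∀ {u v w} → u ≢ w →
    compatible u v ≡ true → compatible v w ≡ true → compatible u w ≡ true
  compatible-trans {u} {v} {w} u≢w uv vw with ∨-cases uv | ∨-cases vw
  ... | inj₁ uv | inj₁ vw = cong (_∨ sameType Gc (C u) (C w)) (cluster-G u v w uv vw u≢w)
  ... | inj₁ uv | inj₂ vw = ∨-introʳ (adj G u w) (subst (λ D → sameType Gc D (C w) ≡ true)
    (clique-cong {H = G} cluster-G (edge (trans (adj-sym G v u) uv))) vw)
  ... | inj₂ uv | inj₁ vw = ∨-introʳ (adj G u w) (subst (λ D → sameType Gc (C u) D ≡ true)
    (clique-cong {H = G} cluster-G (edge vw)) uv)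
  ... | inj₂ uv | inj₂ vw = ∨-introʳ (adj G u w) (⌊⌋-complete (sameType? Gc (C u) (C w))
    (SameType-trans {Gc = Gc} cluster-Gc {C u} {C v} {C w}
      (⌊⌋-sound (sameType? Gc (C u) (C v)) uv) (⌊⌋-sound (sameType? Gc (C v) (C w)) vw)))

  trimmed : Graph n
  trimmed = record
    { adj = λ u v → adj G′ u v ∧ compatible u v
    ; sym = λ u v → cong₂ _∧_ (adj-sym G′ u v)
                      (cong₂ _∨_ (adj-sym G u v) (sameType-sym Gc (C u) (C v)))
    ; irrefl = λ u → cong (_∧ compatible u u) (adj-irrefl G′ u)
    }

  trimmed-cluster : IsCluster trimmed
  trimmed-cluster u v w uv vw u≢w = cong₂ _∧_
    (cluster-G′ u v w (∧-conicalˡ _ _ uv) (∧-conicalˡ _ _ vw) u≢w)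
    (compatible-trans u≢w (∧-conicalʳ _ _ uv) (∧-conicalʳ _ _ vw))

  G⊆trimmed : EdgeSub G trimmed
  G⊆trimmed u v uv = cong₂ _∧_ (G⊆G′ u v uv) (cong (_∨ sameType Gc (C u) (C v)) uv)

  trimmed⊆G′ : EdgeSub trimmed G′
  trimmed⊆G′ u v uv = ∧-conicalˡ _ _ uv

  trimmed-standard : Standard G Gc trimmed
  trimmed-standard x v w v⊆x w⊆x different with ∨-cases (∧-conicalʳ _ _ vw)
    where
    inside-x : ∀ {a} → C a ⊆ clique trimmed x → Near trimmed x a
    inside-x {a} a⊆x = ∋⇒Near ([]=⇒lookup (a⊆x (lookup⇒[]= a (C a) (Near⇒∋ {H = G} here))))
    v≢w : v ≢ w
    v≢w refl = different refl
    vw : adj trimmed v w ≡ true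
    vw = Near⇒adj (Near-trans trimmed-cluster (Near-sym (inside-x v⊆x)) (inside-x w⊆x)) v≢w
  ... | inj₁ adj-G = ⊥-elim (different (clique-cong {H = G} cluster-G (edge adj-G)))
  ... | inj₂ same = ⌊⌋-sound (sameType? Gc (C v) (C w)) same

  deleted : Fin n → Fin n → Bool
  deleted = missing trimmed G′

  compatible-kept : ∀ {u v} → compatible u v ≡ true → deleted u v ≡ false
  compatible-kept {u} {v} uv = trans (cong (λ c → adj G′ u v ∧ not (adj G′ u v ∧ c)) uv)
    (trans (cong (λ a → adj G′ u v ∧ not a) (∧-identityʳ (adj G′ u v))) (∧-inverseʳ (adj G′ u v)))

  deleted-on-block : ∀ {x y u v} → ¬ Near G x y → C x ∋ u ≡ true → C y ∋ v ≡ true →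
    deleted u v ≡ deleted x y
  deleted-on-block {x} {y} {u} {v} far x∋u y∋v = cong₂ (λ a c → a ∧ not (a ∧ c))
    (between-cliques G G′ cluster-G cluster-G′ G⊆G′ far xu yv)
    (cong₂ _∨_ (between-cliques G G cluster-G cluster-G (λ _ _ p → p) far xu yv)
               (cong₂ (sameType Gc) (clique-cong {H = G} cluster-G (Near-sym xu))
                                    (clique-cong {H = G} cluster-G (Near-sym yv))))
    where
    xu : Near G x u
    xu = near x∋u
    yv : Near G y v
    yv = near y∋v

  no-deletions : ∀ x y → (∀ {u v} → C x ∋ u ≡ true → C y ∋ v ≡ true → deleted u v ≡ false) →
    block (C x) (C y) (λ u v → deleted u v ∧ adj Gc u v) ≤
    block (C x) (C y) (λ u v → deleted u v ∧ not (adj Gc u v))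
  no-deletions x y kept = ≤-trans (≤-reflexive (trans
    (block-cong (C x) (C y) (λ x∋u y∋v → cong (_∧ _) (kept x∋u y∋v)))
    (block-empty (C x) (C y)))) z≤n

  -- A block between two distinct cliques of G is deleted entirely or not at all;
  -- if it is deleted, the two cliques have different types and cross-bound applies.
  deleted-between : ∀ x y → ¬ Near G x y →
    block (C x) (C y) (λ u v → deleted u v ∧ adj Gc u v) ≤
    block (C x) (C y) (λ u v → deleted u v ∧ not (adj Gc u v))
  deleted-between x y far with deleted x y in del
  ... | false = no-deletions x y kept
    where
    kept : ∀ {u v} → C x ∋ u ≡ true → C y ∋ v ≡ true → deleted u v ≡ false
    kept x∋u y∋v = trans (deleted-on-block far x∋u y∋v) del
  ... | true = subst₂ _≤_ (block-cong (C x) (C y) (all-deleted (λ c → c)))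
                         (block-cong (C x) (C y) (all-deleted not))
    (cross-bound {H = Gc} cluster-Gc (C x) (C y) different-types)
    where
    all-deleted : (g : Bool → Bool) → ∀ {u v} → C x ∋ u ≡ true → C y ∋ v ≡ true →
      g (adj Gc u v) ≡ (deleted u v ∧ g (adj Gc u v))
    all-deleted g x∋u y∋v =
      cong (_∧ g (adj Gc _ _)) (sym (trans (deleted-on-block far x∋u y∋v) del))
    different-types : ∀ j → ¬ (Majority (C x) (clique Gc j) × Majority (C y) (clique Gc j))
    different-types j maj with () ← trans (sym del)
      (compatible-kept (∨-introʳ (adj G x y) (⌊⌋-complete (sameType? Gc (C x) (C y)) (j , maj))))

  deleted-blockwise : ∀ x y →
    block (C x) (C y) (λ u v → deleted u v ∧ adj Gc u v) ≤
    block (C x) (C y) (λ u v → deleted u v ∧ not (adj Gc u v))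
  deleted-blockwise x y with C x ∋ y in x∋y
  ... | true = no-deletions x y kept
    where
    kept : ∀ {u v} → C x ∋ u ≡ true → C y ∋ v ≡ true → deleted u v ≡ false
    kept x∋u y∋v = missing-Near trimmed G′ G⊆trimmed
      (Near-trans cluster-G (Near-sym (near x∋u)) (Near-trans cluster-G (near x∋y) (near y∋v)))
  ... | false = deleted-between x y (∌⇒¬Near x∋y)

  trimmed-closer : edgeDist trimmed Gc ≤ edgeDist G′ Gc
  trimmed-closer = edgeDist-deletion trimmed G′ Gc trimmed⊆G′
    (Blocks.pairs-mono-by-blocks G cluster-G _ _ deleted-blockwise)

lemma33 : ∀ {n} (G Gc : Graph n) (k d : ℕ) →
    IsCluster G → IsCluster Gc → YesInstance G Gc k d →
    Σ (Graph n) (λ G' → IsSolution G Gc k d G' × Standard G Gc G')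
lemma33 G Gc k d cluster-G cluster-Gc (G′ , cluster-G′ , G⊆G′ , dist-G , dist-Gc) =
  trimmed ,
  (trimmed-cluster , G⊆trimmed ,
   ≤-trans (edgeDist-mono G trimmed G′ G⊆trimmed trimmed⊆G′) dist-G ,
   ≤-trans trimmed-closer dist-Gc) ,
  trimmed-standard
  where open Trimming G Gc G′ cluster-G cluster-Gc cluster-G′ G⊆G′
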